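{- Let $G$ be a multigraph and $U$ its underlying graph. Then $P_{DP}(G,m)\le P_{DP}(U,m)$ and $P^*_{DP}(G,m)=P^*_{DP}(U,m)$ for each $m\in\mathbb{N}$.
   Context: All graphs are finite, nonempty, loopless multigraphs. The underlying graph of $G$ is the simple graph obtained by removing parallel edges (keeping one edge between each adjacent pair). For $u,v\in V(G)$, $E_G(u,v)$ is the set of edges joining $u,v$ and $e_G(u,v)=|E_G(u,v)|$. A cover of $G$ is a triple $\mathcal{H}=(L,H,M)$: $L$ assigns to each vertex a nonempty finite set, $H$ is a multigraph on $\bigcup_x L(x)$, $M$ assigns to each edge $e$ (with endpoints $u,v$) a matching $M(e)$ of $H$ whose edges go between $L(u)$ and $L(v)$, such that the $L(x)$ are pairwise disjoint, each $H[L(x)]$ is complete, $M(e_1)\cap M(e_2)=\emptyset$ for distinct edges, and for distinct $u,v$ the edges of $H$ between $L(u)$ and $L(v)$ are exactly $\bigcup_{e\in E_G(u,v)}M(e)$. It is a full $m$-fold cover if $|L(x)|=m$ for all $x$ and there are exactly $e_G(u,v)m$ edges of $H$ between $L(u)$ and $L(v)$ for all distinct $u,v$. An $\mathcal{H}$-coloring is an independent set of $H$ of size $|V(G)|$; $P_{DP}(G,\mathcal{H})$ is their number; $P_{DP}(G,m)$ and $P^*_{DP}(G,m)$ are the minimum and maximum of $P_{DP}(G,\mathcal{H})$ over all full $m$-fold covers $\mathcal{H}$ of $G$. -}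

module Defs where

open import Data.Nat using (ℕ; zero; suc; _+_; _*_; _≤_; _≥_; _≡ᵇ_)
open import Data.Bool using (Bool; true; false; _∧_; _∨_; not; if_then_else_; T)
open import Data.Fin using (Fin; combine)
import Data.Fin as F
open import Data.Fin.Properties using (_≟_)
open import Data.Vec using (Vec; []; _∷_; lookup)
open import Data.Product using (Σ; _×_; _,_; proj₁; proj₂)
open import Data.Sum using (_⊎_)
open import Relation.Nullary using (¬_)
open import Relation.Nullary.Decidable using (⌊_⌋)
open import Relation.Binary.PropositionalEquality using (_≡_; _≢_)

sumFin : (k : ℕ) → (Fin k → ℕ) → ℕ
sumFin zero    f = 0
sumFin (suc k) f = f F.zero + sumFin k (λ i → f (F.suc i))

countFin : (k : ℕ) → (Fin k → Bool) → ℕ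
countFin k p = sumFin k (λ i → if p i then 1 else 0)

allFin : (k : ℕ) → (Fin k → Bool) → Bool
allFin zero    p = true
allFin (suc k) p = p F.zero ∧ allFin k (λ i → p (F.suc i))

anyFin : (k : ℕ) → (Fin k → Bool) → Bool
anyFin zero    p = false
anyFin (suc k) p = p F.zero ∨ anyFin k (λ i → p (F.suc i))

countSubsets : (k : ℕ) → (Vec Bool k → Bool) → ℕ
countSubsets zero    p = if p [] then 1 else 0
countSubsets (suc k) p =
  countSubsets k (λ S → p (true ∷ S)) + countSubsets k (λ S → p (false ∷ S))

_==_ : ∀ {k} → Fin k → Fin k → Bool
i == j = ⌊ i ≟ j ⌋

-- Loopless multigraphs on the vertex set Fin n.
-- Edges are the elements of Fin E; edge e joins proj₁ (ends e) and
-- proj₂ (ends e) (the orientation is only bookkeeping).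

record Multigraph (n : ℕ) : Set where
  field
    E        : ℕ
    ends     : Fin E → Fin n × Fin n
    loopless : ∀ e → proj₁ (ends e) ≢ proj₂ (ends e)

module _ {n : ℕ} (G : Multigraph n) where
  open Multigraph G

  joins : Fin E → Fin n → Fin n → Bool
  joins e u v = (proj₁ (ends e) == u ∧ proj₂ (ends e) == v)
              ∨ (proj₁ (ends e) == v ∧ proj₂ (ends e) == u)

  mult : Fin n → Fin n → ℕ
  mult u v = countFin E (λ e → joins e u v)

  Adjacent : Fin n → Fin n → Set
  Adjacent u v = Σ (Fin E) λ e → T (joins e u v)

  NoParallel : Set
  NoParallel = ∀ e e′ u v → T (joins e u v) → T (joins e′ u v) → e ≡ e′

IsUnderlyingGraph : ∀ {n} → Multigraph n → Multigraph n → Set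
IsUnderlyingGraph G U =
  NoParallel U ×
  (∀ u v → (Adjacent U u v → Adjacent G u v) × (Adjacent G u v → Adjacent U u v))

-- L(x) = {x} × Fin m (pairwise disjoint, size m);
-- H[L(x)] is complete; for each edge e of G with ends (u,v), M e i j = true
-- means the H-edge (u,i)—(v,j) belongs to the matching M(e).  The H-edges
-- between L(u) and L(v) (u ≠ v) are by construction exactly the disjoint
-- union of the M(e), e ∈ E_G(u,v).

pairCount : (m : ℕ) → (Fin m → Fin m → Bool) → ℕ
pairCount m R = sumFin m (λ i → countFin m (λ j → R i j))

record FullCover {n : ℕ} (G : Multigraph n) (m : ℕ) : Set where
  open Multigraph G
  field
    M : Fin E → Fin m → Fin m → Bool
    matchingˡ : ∀ e i j j′ → T (M e i j) → T (M e i j′) → j ≡ j′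
    matchingʳ : ∀ e i i′ j → T (M e i j) → T (M e i′ j) → i ≡ i′
    -- fullness: exactly e_G(u,v)·m edges of H between L(u) and L(v)
    full : ∀ u v → u ≢ v →
      sumFin E (λ e → if joins G e u v then pairCount m (M e) else 0)
        ≡ mult G u v * m

module _ {n : ℕ} {G : Multigraph n} {m : ℕ} (𝓗 : FullCover G m) where
  open Multigraph G
  open FullCover 𝓗

  HAdj : Fin n → Fin m → Fin n → Fin m → Bool
  HAdj x i y j =
    (x == y ∧ not (i == j))
    ∨ anyFin E (λ e → (proj₁ (ends e) == x ∧ proj₂ (ends e) == y ∧ M e i j)
                     ∨ (proj₁ (ends e) == y ∧ proj₂ (ends e) == x ∧ M e j i))

  -- S ⊆ V(H) = ⋃ L(x), encoded as a characteristic vector over Fin (n * m)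
  member : Vec Bool (n * m) → Fin n → Fin m → Bool
  member S x i = lookup S (combine x i)

  Independent : Vec Bool (n * m) → Bool
  Independent S =
    allFin n λ x → allFin m λ i → allFin n λ y → allFin m λ j →
      not (member S x i ∧ member S y j ∧ HAdj x i y j)

  IsColoring : Vec Bool (n * m) → Bool
  IsColoring S = Independent S ∧ (countFin (n * m) (lookup S) ≡ᵇ n)

  PDPcover : ℕ
  PDPcover = countSubsets (n * m) IsColoring

IsPDP : ∀ {n} → Multigraph n → ℕ → ℕ → Set
IsPDP G m k = Σ (FullCover G m) (λ 𝓗 → PDPcover 𝓗 ≡ k) × ((𝓗 : FullCover G m) → k ≤ PDPcover 𝓗)

IsPDP* : ∀ {n} → Multigraph n → ℕ → ℕ → Set
IsPDP* G m k = Σ (FullCover G m) (λ 𝓗 → PDPcover 𝓗 ≡ k) × ((𝓗 : FullCover G m) → PDPcover 𝓗 ≤ k)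

-- Fullness forces every matching of a full m-fold cover to be perfect.  So a
-- cover of G induces one of U by keeping, for each adjacent pair, the matching
-- of a single parallel edge: this only deletes edges of H, which can only
-- increase the number of colorings.  Conversely a cover of U induces one of G
-- by giving every parallel edge the matching of the corresponding edge of U,
-- and this leaves H unchanged, so the number of colorings is preserved.
module Submission where

open import Defs
open import Data.Nat using (ℕ; zero; suc; _+_; _*_; _≤_; z≤n)
open import Data.Nat.Properties
  using (≤-refl; ≤-reflexive; ≤-trans; ≤-antisym; +-mono-≤; +-monoʳ-≤; +-cancelʳ-≤;
         +-cancelˡ-≡; *-zeroʳ; *-identityʳ; +-commutativeSemigroup)
open import Algebra.Properties.CommutativeSemigroup +-commutativeSemigroup using (interchange)
open import Data.Bool using (Bool; true; false; _∧_; _∨_; not; if_then_else_; T)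
open import Data.Bool.Properties using (T-∧; T-∨; T-≡; ⇔→≡; ∨-comm; if-cong-then)
open import Data.Unit using (tt)
open import Data.Empty using (⊥-elim)
open import Data.Fin using (Fin; zero; suc)
open import Data.Fin.Properties using (_≟_; 0≢1+n; suc-injective)
open import Data.Vec using (Vec; []; _∷_)
open import Data.Product using (∃; _×_; _,_; proj₁; proj₂)
open import Data.Product.Function.NonDependent.Propositional using (_×-⇔_)
open import Data.Sum using (_⊎_; inj₁; inj₂; [_,_]′)
import Data.Sum as Sum
open import Data.Sum.Function.Propositional using (_⊎-⇔_)
open import Function using (_∘_; flip; _⇔_; mk⇔; Equivalence)
import Function.Properties.Equivalence as ⇔
open import Relation.Nullary using (¬_)
open import Relation.Nullary.Decidable using (toWitness; fromWitness)
open import Relation.Binary.PropositionalEquality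

open Equivalence using (to; from)

T-== : ∀ {k} {i j : Fin k} → T (i == j) ⇔ i ≡ j
T-== {i = i} {j} = mk⇔ (toWitness {a? = i ≟ j}) (fromWitness {a? = i ≟ j})

T-⇔⇒≡ : ∀ {x y} → T x ⇔ T y → x ≡ y
T-⇔⇒≡ x⇔y = ⇔→≡ (⇔.trans (⇔.sym T-≡) (⇔.trans x⇔y T-≡))

T-not-antitone : ∀ {x y} → (T y → T x) → T (not x) → T (not y)
T-not-antitone {y = false} _ _     = tt
T-not-antitone {false} {true} y⇒x _ = y⇒x tt

T-∧-monoʳ : ∀ x {y z} → (T y → T z) → T (x ∧ y) → T (x ∧ z)
T-∧-monoʳ true y⇒z = y⇒z

T-allFin : ∀ k {p : Fin k → Bool} → T (allFin k p) ⇔ (∀ i → T (p i))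
T-allFin zero    = mk⇔ (λ _ ()) (λ _ → tt)
T-allFin (suc k) = mk⇔
  (λ t → λ { zero → proj₁ (to T-∧ t) ; (suc i) → to (T-allFin k) (proj₂ (to T-∧ t)) i })
  (λ h → from T-∧ (h zero , from (T-allFin k) (h ∘ suc)))

T-anyFin : ∀ k {p : Fin k → Bool} → T (anyFin k p) ⇔ ∃ λ i → T (p i)
T-anyFin zero    = mk⇔ (λ ()) (λ ())
T-anyFin (suc k) = mk⇔
  (λ t → [ (zero ,_) , (λ (i , t) → suc i , t) ∘ to (T-anyFin k) ]′ (to T-∨ t))
  (λ { (zero , t) → from T-∨ (inj₁ t) ; (suc i , t) → from T-∨ (inj₂ (from (T-anyFin k) (i , t))) })

countSubsets-mono : ∀ k {p q : Vec Bool k → Bool} → (∀ S → T (p S) → T (q S)) →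
  countSubsets k p ≤ countSubsets k q
countSubsets-mono zero {p} {q} p⇒q with p [] | q [] | p⇒q []
... | true  | true  | _   = ≤-refl
... | true  | false | p⇒q[] = ⊥-elim (p⇒q[] tt)
... | false | _     | _   = z≤n
countSubsets-mono (suc k) p⇒q =
  +-mono-≤ (countSubsets-mono k (p⇒q ∘ (true ∷_))) (countSubsets-mono k (p⇒q ∘ (false ∷_)))

sumFin-cong : ∀ k {f g : Fin k → ℕ} → (∀ i → f i ≡ g i) → sumFin k f ≡ sumFin k g
sumFin-cong zero    f≗g = refl
sumFin-cong (suc k) f≗g = cong₂ _+_ (f≗g zero) (sumFin-cong k (f≗g ∘ suc))

sumFin-mono-≤ : ∀ k {f g : Fin k → ℕ} → (∀ i → f i ≤ g i) → sumFin k f ≤ sumFin k g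
sumFin-mono-≤ zero    f≤g = z≤n
sumFin-mono-≤ (suc k) f≤g = +-mono-≤ (f≤g zero) (sumFin-mono-≤ k (f≤g ∘ suc))

sumFin-const : ∀ k x → sumFin k (λ _ → x) ≡ k * x
sumFin-const zero    x = refl
sumFin-const (suc k) x = cong (x +_) (sumFin-const k x)

sumFin-distrib-+ : ∀ k (f g : Fin k → ℕ) →
  sumFin k (λ i → f i + g i) ≡ sumFin k f + sumFin k g
sumFin-distrib-+ zero    f g = refl
sumFin-distrib-+ (suc k) f g =
  trans (cong (f zero + g zero +_) (sumFin-distrib-+ k (f ∘ suc) (g ∘ suc)))
        (interchange (f zero) (g zero) _ _)

sumFin-comm : ∀ a b (f : Fin a → Fin b → ℕ) →
  sumFin a (λ i → sumFin b (f i)) ≡ sumFin b (λ j → sumFin a (λ i → f i j))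
sumFin-comm zero    b f = sym (trans (sumFin-const b 0) (*-zeroʳ b))
sumFin-comm (suc a) b f =
  trans (cong (sumFin b (f zero) +_) (sumFin-comm a b (f ∘ suc)))
        (sym (sumFin-distrib-+ b (f zero) (λ j → sumFin a (λ i → f (suc i) j))))

sumFin-indicator : ∀ k (p : Fin k → Bool) x →
  sumFin k (λ i → if p i then x else 0) ≡ countFin k p * x
sumFin-indicator zero    p x = refl
sumFin-indicator (suc k) p x with p zero
... | true  = cong (x +_) (sumFin-indicator k (p ∘ suc) x)
... | false = sumFin-indicator k (p ∘ suc) x

sumFin-≤-≡⇒≗ : ∀ k {f g : Fin k → ℕ} → (∀ i → f i ≤ g i) → sumFin k f ≡ sumFin k g →
  ∀ i → f i ≡ g i
sumFin-≤-≡⇒≗ (suc k) {f} {g} f≤g Σf≡Σg = λ where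
    zero    → head≡
    (suc i) → sumFin-≤-≡⇒≗ k (f≤g ∘ suc) tail≡ i
  where
  tail≤ : sumFin k (f ∘ suc) ≤ sumFin k (g ∘ suc)
  tail≤ = sumFin-mono-≤ k (f≤g ∘ suc)
  head≡ : f zero ≡ g zero
  head≡ = ≤-antisym (f≤g zero)
    (+-cancelʳ-≤ _ _ _ (≤-trans (≤-reflexive (sym Σf≡Σg)) (+-monoʳ-≤ (f zero) tail≤)))
  tail≡ : sumFin k (f ∘ suc) ≡ sumFin k (g ∘ suc)
  tail≡ = +-cancelˡ-≡ (f zero) _ _ (trans Σf≡Σg (cong (_+ _) (sym head≡)))

countFin-none : ∀ k (p : Fin k → Bool) → (∀ i → ¬ T (p i)) → countFin k p ≡ 0
countFin-none zero    p none = refl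
countFin-none (suc k) p none with p zero | none zero
... | true  | ¬p0 = ⊥-elim (¬p0 tt)
... | false | _   = countFin-none k (p ∘ suc) (none ∘ suc)

countFin-unique : ∀ k (p : Fin k → Bool) → (∀ i i′ → T (p i) → T (p i′) → i ≡ i′) →
  countFin k p ≤ 1
countFin-unique zero    p unique = z≤n
countFin-unique (suc k) p unique with p zero in p0≡
... | true  = ≤-reflexive (cong suc (countFin-none k (p ∘ suc)
                λ i p[1+i] → 0≢1+n (unique zero (suc i) (subst T (sym p0≡) tt) p[1+i])))
... | false = countFin-unique k (p ∘ suc) λ i i′ pi pi′ → suc-injective (unique _ _ pi pi′)

pairCount-cong : ∀ m {R R′ : Fin m → Fin m → Bool} → (∀ i j → T (R i j) ⇔ T (R′ i j)) →
  pairCount m R ≡ pairCount m R′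
pairCount-cong m R⇔R′ =
  sumFin-cong m λ i → sumFin-cong m λ j → cong (λ b → if b then 1 else 0) (T-⇔⇒≡ (R⇔R′ i j))

pairCount-flip : ∀ m (R : Fin m → Fin m → Bool) → pairCount m (flip R) ≡ pairCount m R
pairCount-flip m R = sumFin-comm m m (λ i j → if R j i then 1 else 0)

pairCount-functional : ∀ m (R : Fin m → Fin m → Bool) →
  (∀ i j j′ → T (R i j) → T (R i j′) → j ≡ j′) → pairCount m R ≤ m
pairCount-functional m R functional = ≤-trans
  (sumFin-mono-≤ m λ i → countFin-unique m (R i) (functional i))
  (≤-reflexive (trans (sumFin-const m 1) (*-identityʳ m)))

module _ {n : ℕ} (G : Multigraph n) where
  open Multigraph G

  src tgt : Fin E → Fin n
  src e = proj₁ (ends e)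
  tgt e = proj₂ (ends e)

  T-joins : ∀ {e u v} →
    T (joins G e u v) ⇔ ((src e ≡ u × tgt e ≡ v) ⊎ (src e ≡ v × tgt e ≡ u))
  T-joins = ⇔.trans T-∨ (⇔.trans T-∧ (T-== ×-⇔ T-==) ⊎-⇔ ⇔.trans T-∧ (T-== ×-⇔ T-==))

  joins-ends : ∀ e → T (joins G e (src e) (tgt e))
  joins-ends e = from T-joins (inj₁ (refl , refl))

  joins-sym : ∀ {e u v} → T (joins G e u v) → T (joins G e v u)
  joins-sym = from T-joins ∘ Sum.swap ∘ to T-joins

module _ {n : ℕ} {G : Multigraph n} {m : ℕ} (𝓗 : FullCover G m) where
  open Multigraph G
  open FullCover 𝓗

  linkedBy : Fin E → Fin n → Fin m → Fin n → Fin m → Bool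
  linkedBy e x i y j = (src G e == x ∧ tgt G e == y ∧ M e i j)
                     ∨ (src G e == y ∧ tgt G e == x ∧ M e j i)

  T-linkedBy : ∀ {e x i y j} → T (linkedBy e x i y j) ⇔
    ((src G e ≡ x × tgt G e ≡ y × T (M e i j)) ⊎ (src G e ≡ y × tgt G e ≡ x × T (M e j i)))
  T-linkedBy = ⇔.trans T-∨ (T-∧₃ ⊎-⇔ T-∧₃)
    where
    T-∧₃ : ∀ {k} {a b c d : Fin k} {r} → T (a == b ∧ c == d ∧ r) ⇔ (a ≡ b × c ≡ d × T r)
    T-∧₃ = ⇔.trans T-∧ (T-== ×-⇔ ⇔.trans T-∧ (T-== ×-⇔ ⇔.refl))

  linkedBy-sym : ∀ e x i y j → linkedBy e x i y j ≡ linkedBy e y j x i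
  linkedBy-sym e x i y j = ∨-comm (src G e == x ∧ tgt G e == y ∧ M e i j) _

  linkedBy⇒joins : ∀ {e x i y j} → T (linkedBy e x i y j) → T (joins G e x y)
  linkedBy⇒joins t =
    from (T-joins G) (Sum.map (λ (p , q , _) → p , q) (λ (p , q , _) → p , q) (to T-linkedBy t))

  linkedBy-along : ∀ {e x y i j} → src G e ≡ x → tgt G e ≡ y → x ≢ y →
    T (linkedBy e x i y j) ⇔ T (M e i j)
  linkedBy-along src≡x tgt≡y x≢y = mk⇔
    (λ t → [ (λ (_ , _ , r) → r) , (λ (src≡y , _) → ⊥-elim (x≢y (trans (sym src≡x) src≡y))) ]′
             (to T-linkedBy t))
    (λ r → from T-linkedBy (inj₁ (src≡x , tgt≡y , r)))

  -- No M(e) has more than m edges, while together the edges parallel to e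
  -- must carry e_G(u,v)·m of them.
  matching-perfect : ∀ e → pairCount m (M e) ≡ m
  matching-perfect e = begin
    pairCount m (M e)                                      ≡⟨ if-true (joins-ends G e) ⟨
    term e                                                 ≡⟨ term≡bound e ⟩
    (if joins G e (src G e) (tgt G e) then m else 0)       ≡⟨ if-true (joins-ends G e) ⟩
    m                                                      ∎
    where
    open ≡-Reasoning
    if-true : ∀ {b} {x y : ℕ} → T b → (if b then x else y) ≡ x
    if-true {true} _ = refl
    term bound : Fin E → ℕ
    term  f = if joins G f (src G e) (tgt G e) then pairCount m (M f) else 0
    bound f = if joins G f (src G e) (tgt G e) then m else 0
    term≤bound : ∀ f → term f ≤ bound f
    term≤bound f with joins G f (src G e) (tgt G e)
    ... | true  = pairCount-functional m (M f) (matchingˡ f)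
    ... | false = z≤n
    term≡bound : ∀ f → term f ≡ bound f
    term≡bound = sumFin-≤-≡⇒≗ E term≤bound
      (trans (full _ _ (loopless e)) (sym (sumFin-indicator E _ m)))

  HEdge : Fin n → Fin m → Fin n → Fin m → Set
  HEdge x i y j = ∃ λ e → T (linkedBy e x i y j)

module _ {n m : ℕ} {G₁ G₂ : Multigraph n} (𝓗₁ : FullCover G₁ m) (𝓗₂ : FullCover G₂ m)
  (HEdge⊆ : ∀ {x i y j} → HEdge 𝓗₁ x i y j → HEdge 𝓗₂ x i y j) where

  HAdj-mono : ∀ x i y j → T (HAdj 𝓗₁ x i y j) → T (HAdj 𝓗₂ x i y j)
  HAdj-mono x i y j t = from T-∨ (Sum.map₂ cross (to T-∨ t))
    where
    cross : T (anyFin (Multigraph.E G₁) _) → T (anyFin (Multigraph.E G₂) _)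
    cross = from (T-anyFin _) ∘ HEdge⊆ ∘ to (T-anyFin _)

  IsColoring-antitone : ∀ S → T (IsColoring 𝓗₂ S) → T (IsColoring 𝓗₁ S)
  IsColoring-antitone S t = from T-∧ (independent₁ , proj₂ (to T-∧ t))
    where
    independent₂ : ∀ x i y j → T (not (member 𝓗₂ S x i ∧ member 𝓗₂ S y j ∧ HAdj 𝓗₂ x i y j))
    independent₂ x i y j = to (T-allFin m)
      (to (T-allFin n) (to (T-allFin m) (to (T-allFin n) (proj₁ (to T-∧ t)) x) i) y) j
    independent₁ : T (Independent 𝓗₁ S)
    independent₁ =
      from (T-allFin n) λ x → from (T-allFin m) λ i → from (T-allFin n) λ y → from (T-allFin m) λ j →
      T-not-antitone (T-∧-monoʳ (member 𝓗₁ S x i) (T-∧-monoʳ (member 𝓗₁ S y j) (HAdj-mono x i y j)))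
        (independent₂ x i y j)

  PDPcover-antitone : PDPcover 𝓗₂ ≤ PDPcover 𝓗₁
  PDPcover-antitone = countSubsets-mono (n * m) IsColoring-antitone

-- Given, for every edge of G′, a parallel edge of G, a full cover of G
-- induces one of G′ by reusing the matching of the parallel edge.
module Transport {n : ℕ} {G G′ : Multigraph n}
  (parallel : ∀ e′ → ∃ λ e → T (joins G e (src G′ e′) (tgt G′ e′)))
  {m : ℕ} (𝓗 : FullCover G m) where
  open Multigraph
  open FullCover 𝓗

  chosen : Fin (E G′) → Fin (E G)
  chosen e′ = proj₁ (parallel e′)

  chosen-joins : ∀ {e′ u v} → T (joins G′ e′ u v) → T (joins G (chosen e′) u v)
  chosen-joins {e′} joined with to (T-joins G′) joined
  ... | inj₁ (refl , refl) = proj₂ (parallel e′)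
  ... | inj₂ (refl , refl) = joins-sym G (proj₂ (parallel e′))

  M′ : Fin (E G′) → Fin m → Fin m → Bool
  M′ e′ i j = linkedBy 𝓗 (chosen e′) (src G′ e′) i (tgt G′ e′) j

  orientation : ∀ e′ → (∀ i j → T (M′ e′ i j) ⇔ T (M (chosen e′) i j))
                     ⊎ (∀ i j → T (M′ e′ i j) ⇔ T (M (chosen e′) j i))
  orientation e′ with to (T-joins G) (proj₂ (parallel e′))
  ... | inj₁ (src≡ , tgt≡) = inj₁ λ i j → linkedBy-along 𝓗 src≡ tgt≡ (loopless G′ e′)
  ... | inj₂ (src≡ , tgt≡) = inj₂ λ i j →
    subst (λ b → T b ⇔ _) (sym (linkedBy-sym 𝓗 _ _ i _ j))
          (linkedBy-along 𝓗 src≡ tgt≡ (loopless G′ e′ ∘ sym))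

  matchingˡ′ : ∀ e′ i j j′ → T (M′ e′ i j) → T (M′ e′ i j′) → j ≡ j′
  matchingˡ′ e′ i j j′ t t′ with orientation e′
  ... | inj₁ same = matchingˡ _ i j j′ (to (same i j) t) (to (same i j′) t′)
  ... | inj₂ flipped = matchingʳ _ j j′ i (to (flipped i j) t) (to (flipped i j′) t′)

  matchingʳ′ : ∀ e′ i i′ j → T (M′ e′ i j) → T (M′ e′ i′ j) → i ≡ i′
  matchingʳ′ e′ i i′ j t t′ with orientation e′
  ... | inj₁ same = matchingʳ _ i i′ j (to (same i j) t) (to (same i′ j) t′)
  ... | inj₂ flipped = matchingˡ _ j i i′ (to (flipped i j) t) (to (flipped i′ j) t′)

  perfect′ : ∀ e′ → pairCount m (M′ e′) ≡ m
  perfect′ e′ with orientation e′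
  ... | inj₁ same    = trans (pairCount-cong m same) (matching-perfect 𝓗 _)
  ... | inj₂ flipped = trans (pairCount-cong m flipped)
                             (trans (pairCount-flip m (M _)) (matching-perfect 𝓗 _))

  transport : FullCover G′ m
  transport = record
    { M = M′ ; matchingˡ = matchingˡ′ ; matchingʳ = matchingʳ′
    ; full = λ u v _ → trans (sumFin-cong _ λ e′ → if-cong-then (joins G′ e′ u v) (perfect′ e′))
                             (sumFin-indicator (E G′) (λ e′ → joins G′ e′ u v) m) }

  T-linkedBy-transport : ∀ {e′ x i y j} → T (linkedBy transport e′ x i y j) ⇔
    (T (joins G′ e′ x y) × T (linkedBy 𝓗 (chosen e′) x i y j))
  T-linkedBy-transport {e′} {x} {i} {y} {j} = mk⇔
    (λ t → linkedBy⇒joins transport t , [ forwards , backwards ]′ (to (T-linkedBy transport) t))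
    (λ (joined , t) →
      from (T-linkedBy transport) (Sum.map (along t) (against t) (to (T-joins G′) joined)))
    where
    along : T (linkedBy 𝓗 (chosen e′) x i y j) → src G′ e′ ≡ x × tgt G′ e′ ≡ y →
      src G′ e′ ≡ x × tgt G′ e′ ≡ y × T (M′ e′ i j)
    along t (refl , refl) = refl , refl , t
    against : T (linkedBy 𝓗 (chosen e′) x i y j) → src G′ e′ ≡ y × tgt G′ e′ ≡ x →
      src G′ e′ ≡ y × tgt G′ e′ ≡ x × T (M′ e′ j i)
    against t (refl , refl) = refl , refl , subst T (linkedBy-sym 𝓗 (chosen e′) x i y j) t
    forwards : src G′ e′ ≡ x × tgt G′ e′ ≡ y × T (M′ e′ i j) → T (linkedBy 𝓗 (chosen e′) x i y j)
    forwards (refl , refl , t) = t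
    backwards : src G′ e′ ≡ y × tgt G′ e′ ≡ x × T (M′ e′ j i) → T (linkedBy 𝓗 (chosen e′) x i y j)
    backwards (refl , refl , t) = subst T (linkedBy-sym 𝓗 _ _ j _ i) t

  PDPcover-≤-transport : PDPcover 𝓗 ≤ PDPcover transport
  PDPcover-≤-transport = PDPcover-antitone transport 𝓗
    λ (e′ , t) → chosen e′ , proj₂ (to T-linkedBy-transport t)

  -- Without parallel edges in G, the chosen edge is the only candidate, so
  -- the H-edges of the two covers coincide.
  PDPcover-transport : NoParallel G → (∀ u v → Adjacent G u v → Adjacent G′ u v) →
    PDPcover transport ≡ PDPcover 𝓗
  PDPcover-transport simple adjacent = ≤-antisym
    (PDPcover-antitone 𝓗 transport HEdge⊆)
    PDPcover-≤-transport
    where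
    HEdge⊆ : ∀ {x i y j} → HEdge 𝓗 x i y j → HEdge transport x i y j
    HEdge⊆ {x} {i} {y} {j} (e , t) with adjacent x y (e , linkedBy⇒joins 𝓗 t)
    ... | e′ , joined′ =
      e′ , from T-linkedBy-transport (joined′ , subst (λ f → T (linkedBy 𝓗 f x i y j)) e≡chosen t)
      where
      e≡chosen : e ≡ chosen e′
      e≡chosen = simple e (chosen e′) x y (linkedBy⇒joins 𝓗 t) (chosen-joins joined′)

proposition9 : ∀ {n} → 1 ≤ n → (G U : Multigraph n) → IsUnderlyingGraph G U →
    ∀ m → 1 ≤ m →
      (∀ a b → IsPDP G m a → IsPDP U m b → a ≤ b)
      × (∀ a b → IsPDP* G m a → IsPDP* U m b → a ≡ b)
proposition9 _ G U (simple , sameAdjacency) m _ = minimum , maximum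
  where
  module G→U = Transport {G = G} {G′ = U} (λ f → proj₁ (sameAdjacency _ _) (f , joins-ends U f))
  module U→G = Transport {G = U} {G′ = G} (λ e → proj₂ (sameAdjacency _ _) (e , joins-ends G e))

  U→G-exact : (𝓗 : FullCover U m) → PDPcover (U→G.transport 𝓗) ≡ PDPcover 𝓗
  U→G-exact 𝓗 = U→G.PDPcover-transport 𝓗 simple λ u v → proj₁ (sameAdjacency u v)

  minimum : ∀ a b → IsPDP G m a → IsPDP U m b → a ≤ b
  minimum _ _ (_ , a≤) ((𝓗ᵁ , refl) , _) =
    ≤-trans (a≤ (U→G.transport 𝓗ᵁ)) (≤-reflexive (U→G-exact 𝓗ᵁ))

  maximum : ∀ a b → IsPDP* G m a → IsPDP* U m b → a ≡ b
  maximum _ _ ((𝓗ᴳ , refl) , ≤a) ((𝓗ᵁ , refl) , ≤b) = ≤-antisym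
    (≤-trans (G→U.PDPcover-≤-transport 𝓗ᴳ) (≤b (G→U.transport 𝓗ᴳ)))
    (≤-trans (≤-reflexive (sym (U→G-exact 𝓗ᵁ))) (≤a (U→G.transport 𝓗ᵁ)))
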